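{- For every $\kappa\ge3$ and every reduced fraction $p/q$ in level $\ell_\kappa$ of the Farey binary tree, the sum of the degrees of the first and last nodes of the Haros graph $G_{p/q}$ equals $\kappa+2$.
   Context: Farey binary tree: $\ell_1=\{0/1,1/1\}$, and $\ell_{n+1}$ consists of the mediants $\frac{p+p'}{q+q'}$ of all pairs $p/q<p'/q'$ adjacent (in increasing order) in $\bigcup_{i\le n}\ell_i$ (so $\ell_2=\{1/2\}$, $\ell_3=\{1/3,2/3\}$, $\ell_4=\{1/4,2/5,3/5,3/4\}$). Each reduced $p/q\in(0,1)$ is the mediant of a unique adjacent pair $p_1/q_1<p_2/q_2$ (its parents). Haros graphs: graphs with linearly ordered nodes. $G_0$ has two nodes joined by an edge. For $G$ with nodes $v_1,\dots,v_a$ and $G'$ with nodes $w_1,\dots,w_b$, $G\oplus G'$ has nodes $u_1,\dots,u_{a+b-1}$ obtained by identifying $v_a$ with $w_1$ (so $u_i=v_i$ for $i\le a$, $u_{a-1+j}=w_j$), keeping all edges of $G$ and $G'$, and adding an edge $u_1u_{a+b-1}$. $G_{0/1}=G_{1/1}=G_0$ and $G_{p/q}=G_{p_1/q_1}\oplus G_{p_2/q_2}$; $G_{p/q}$ has $q+1$ nodes. -}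

module Defs where

open import Data.Nat using (ℕ; zero; suc; _+_; _∸_; _≟_)
open import Data.Product using (_×_; _,_; proj₁; proj₂)
open import Data.List using (List; []; _∷_; _++_; map; filter; length)
open import Data.Sum using (_⊎_)
open import Relation.Nullary.Decidable using (_⊎-dec_)

-- A graph on linearly ordered nodes 0 , 1 , … , size - 1 (node i = u_{i+1}),
-- given by its list of edges.
record Graph : Set where
  constructor graph
  field
    size  : ℕ
    edges : List (ℕ × ℕ)
open Graph public

G₀ : Graph
G₀ = graph 2 ((0 , 1) ∷ [])

shiftEdge : ℕ → ℕ × ℕ → ℕ × ℕ
shiftEdge k (i , j) = (k + i , k + j)

-- G ⊕ G' : identify the last node of G with the first node of G',
-- keep all edges, add an edge between the first and the last node.
_⊕_ : Graph → Graph → Graph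
graph a E ⊕ graph b E' =
  graph (a + b ∸ 1)
        (E ++ map (shiftEdge (a ∸ 1)) E' ++ ((0 , a + b ∸ 2) ∷ []))

degree : Graph → ℕ → ℕ
degree G i = length (filter (λ e → (proj₁ e ≟ i) ⊎-dec (proj₂ e ≟ i)) (edges G))

firstNode : Graph → ℕ
firstNode G = 0

lastNode : Graph → ℕ
lastNode G = size G ∸ 1

-- A node of the Farey binary tree: the fraction p/q together with its Haros graph.
record FNode : Set where
  constructor fnode
  field
    num   : ℕ
    den   : ℕ
    haros : Graph
open FNode public

-- mediant of two adjacent fractions; the Haros graph of the mediant is
-- G_{p1/q1} ⊕ G_{p2/q2}, the two being the parents of the mediant.
mediant : FNode → FNode → FNode
mediant (fnode p q G) (fnode p' q' G') = fnode (p + p') (q + q') (G ⊕ G')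

mediants : List FNode → List FNode
mediants (x ∷ y ∷ xs) = mediant x y ∷ mediants (y ∷ xs)
mediants _ = []

refine : List FNode → List FNode
refine (x ∷ y ∷ xs) = x ∷ mediant x y ∷ refine (y ∷ xs)
refine xs = xs

base : List FNode
base = fnode 0 1 G₀ ∷ fnode 1 1 G₀ ∷ []

-- upTo k = ⋃_{i ≤ k+1} ℓ_i , in increasing order
upTo : ℕ → List FNode
upTo zero = base
upTo (suc k) = refine (upTo k)

-- level n = ℓ_n  (ℓ_0 is empty by convention; it is never used)
level : ℕ → List FNode
level zero = []
level (suc zero) = base
level (suc (suc k)) = mediants (upTo k)

-- Let first(x), last(x) be the degrees of the first and last node of the
-- Haros graph of x.  The operation G ⊕ G' adds one edge at its first node and
-- one at its last node, while the first node of G ⊕ G' is that of G and the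
-- last one is that of G'; hence first(m) = first(x) + 1 and last(m) = last(y) + 1
-- for the mediant m of x < y.  So the invariant "first(x) + last(y) = k + 2 for
-- adjacent x < y in ℓ₁ ∪ … ∪ ℓ_{k+1}" survives the insertion of mediants, and
-- a mediant of such a pair has first(m) + last(m) = k + 4.
module Submission where

open import Defs
open import Data.Nat using (ℕ; zero; suc; _+_; _∸_; _≤_; _<_; _≟_; s≤s; z≤n)
open import Data.Nat.Properties using (+-comm; +-suc; +-cancelˡ-≡; +-monoʳ-<; ≤-trans; ≤-reflexive; m≤n⇒m≤1+n; m≤n+m; <-irrefl; n<1+n)
open import Data.Product using (_×_; _,_; proj₁; proj₂; ∃₂)
open import Data.Sum using (_⊎_; inj₁; inj₂)
open import Data.List using (List; []; _∷_; _++_; map; filter; length)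
open import Data.List.Properties using (length-++; filter-++; filter-none; filter-accept; filter-reject)
open import Data.List.Relation.Unary.All as All using (All; []; _∷_)
open import Data.List.Relation.Unary.All.Properties using (++⁺; map⁺)
open import Data.List.Relation.Unary.Linked using (Linked; []; [-]; _∷_)
open import Data.List.Relation.Unary.Any using (here; there)
open import Data.List.Membership.Propositional using (_∈_)
open import Relation.Nullary using (¬_; Dec; yes; no)
open import Relation.Nullary.Decidable using (_⊎-dec_)
open import Relation.Binary.PropositionalEquality using (_≡_; refl; cong; cong₂)
open Relation.Binary.PropositionalEquality.≡-Reasoning

Edge : Set
Edge = ℕ × ℕ

Incident : ℕ → Edge → Set
Incident i e = proj₁ e ≡ i ⊎ proj₂ e ≡ i

incident? : (i : ℕ) (e : Edge) → Dec (Incident i e)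
incident? i e = (proj₁ e ≟ i) ⊎-dec (proj₂ e ≟ i)

degreeIn : List Edge → ℕ → ℕ
degreeIn E i = length (filter (incident? i) E)

degreeIn-++ : ∀ E E' i → degreeIn (E ++ E') i ≡ degreeIn E i + degreeIn E' i
degreeIn-++ E E' i = begin
  length (filter (incident? i) (E ++ E'))                       ≡⟨ cong length (filter-++ (incident? i) E E') ⟩
  length (filter (incident? i) E ++ filter (incident? i) E')    ≡⟨ length-++ (filter (incident? i) E) ⟩
  degreeIn E i + degreeIn E' i                                  ∎

degreeIn-avoiding : ∀ {E i} → All (λ e → ¬ Incident i e) E → degreeIn E i ≡ 0
degreeIn-avoiding {i = i} avoid = cong length (filter-none (incident? i) avoid)

degreeIn-single : ∀ e i → Incident i e → degreeIn (e ∷ []) i ≡ 1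
degreeIn-single e i inc = cong length (filter-accept (incident? i) inc)

incident-shiftEdge⁺ : ∀ {k i e} → Incident i e → Incident (k + i) (shiftEdge k e)
incident-shiftEdge⁺ {k} (inj₁ eq) = inj₁ (cong (k +_) eq)
incident-shiftEdge⁺ {k} (inj₂ eq) = inj₂ (cong (k +_) eq)

incident-shiftEdge⁻ : ∀ {k i e} → Incident (k + i) (shiftEdge k e) → Incident i e
incident-shiftEdge⁻ {k} (inj₁ eq) = inj₁ (+-cancelˡ-≡ k _ _ eq)
incident-shiftEdge⁻ {k} (inj₂ eq) = inj₂ (+-cancelˡ-≡ k _ _ eq)

degreeIn-shift : ∀ k i E → degreeIn (map (shiftEdge k) E) (k + i) ≡ degreeIn E i
degreeIn-shift k i [] = refl
degreeIn-shift k i (e ∷ E) with ih ← degreeIn-shift k i E | incident? i e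
... | yes inc = begin
  degreeIn (shiftEdge k e ∷ map (shiftEdge k) E) (k + i)
    ≡⟨ cong length (filter-accept (incident? (k + i)) (incident-shiftEdge⁺ inc)) ⟩
  suc (degreeIn (map (shiftEdge k) E) (k + i))            ≡⟨ cong suc ih ⟩
  suc (degreeIn E i)
    ≡⟨ cong length (filter-accept (incident? i) inc) ⟨
  degreeIn (e ∷ E) i                                      ∎
... | no ¬inc = begin
  degreeIn (shiftEdge k e ∷ map (shiftEdge k) E) (k + i)
    ≡⟨ cong length (filter-reject (incident? (k + i)) (λ inc → ¬inc (incident-shiftEdge⁻ inc))) ⟩
  degreeIn (map (shiftEdge k) E) (k + i)                  ≡⟨ ih ⟩
  degreeIn E i
    ≡⟨ cong length (filter-reject (incident? i) ¬inc) ⟨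
  degreeIn (e ∷ E) i                                      ∎

EdgeBelow : ℕ → Edge → Set
EdgeBelow n e = proj₁ e < n × proj₂ e < n

¬incident-above : ∀ {n i e} → n ≤ i → EdgeBelow n e → ¬ Incident i e
¬incident-above n≤i (p , q) (inj₁ refl) = <-irrefl refl (≤-trans p n≤i)
¬incident-above n≤i (p , q) (inj₂ refl) = <-irrefl refl (≤-trans q n≤i)

-- This is what makes the edges of G and the shifted edges of G' miss the ends of G ⊕ G'.
WellFormed : Graph → Set
WellFormed G = 2 ≤ size G × All (EdgeBelow (size G)) (edges G)

wellFormed-G₀ : WellFormed G₀
wellFormed-G₀ = s≤s (s≤s z≤n) , (s≤s z≤n , n<1+n 1) ∷ []

node-bound-⊕ : ∀ a b → 2 + a ≤ a + (2 + b)
node-bound-⊕ a b = ≤-trans (s≤s (s≤s (m≤n+m a b))) (≤-reflexive (+-comm (2 + b) a))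

wellFormed-⊕ : ∀ {G G'} → WellFormed G → WellFormed G' → WellFormed (G ⊕ G')
wellFormed-⊕ {graph (suc (suc a)) E} {graph (suc (suc b)) E'} (s≤s (s≤s z≤n) , below) (s≤s (s≤s z≤n) , below') =
  ≤-trans (s≤s (s≤s z≤n)) size≤ ,
  ++⁺ (All.map (λ (p , q) → ≤-trans p size≤ , ≤-trans q size≤) below)
      (++⁺ (map⁺ (All.map (λ (p , q) → +-monoʳ-< (suc a) p , +-monoʳ-< (suc a) q) below'))
           ((s≤s z≤n , n<1+n _) ∷ []))
  where
    size≤ : 2 + a ≤ suc (a + (2 + b))
    size≤ = m≤n⇒m≤1+n (node-bound-⊕ a b)

degree-first-⊕ : ∀ G G' → 2 ≤ size G →
  degree (G ⊕ G') (firstNode (G ⊕ G')) ≡ suc (degree G (firstNode G))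
degree-first-⊕ (graph (suc (suc a)) E) (graph b E') (s≤s (s≤s z≤n)) = begin
  degreeIn (E ++ shifted ++ newEdge) 0                  ≡⟨ degreeIn-++ E (shifted ++ newEdge) 0 ⟩
  degreeIn E 0 + degreeIn (shifted ++ newEdge) 0        ≡⟨ cong (degreeIn E 0 +_) (degreeIn-++ shifted newEdge 0) ⟩
  degreeIn E 0 + (degreeIn shifted 0 + degreeIn newEdge 0)
    ≡⟨ cong (degreeIn E 0 +_) (cong₂ _+_ (degreeIn-avoiding (avoids-0 E')) (degreeIn-single (0 , L) 0 (inj₁ refl))) ⟩
  degreeIn E 0 + 1                                      ≡⟨ +-comm (degreeIn E 0) 1 ⟩
  suc (degreeIn E 0)                                    ∎
  where
    L = suc (suc a) + b ∸ 2
    shifted = map (shiftEdge (suc a)) E'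
    newEdge = (0 , L) ∷ []
    avoids-0 : ∀ E' → All (λ e → ¬ Incident 0 e) (map (shiftEdge (suc a)) E')
    avoids-0 [] = []
    avoids-0 (e ∷ E') = (λ { (inj₁ ()) ; (inj₂ ()) }) ∷ avoids-0 E'

degree-last-⊕ : ∀ G G' → WellFormed G → 2 ≤ size G' →
  degree (G ⊕ G') (lastNode (G ⊕ G')) ≡ suc (degree G' (lastNode G'))
degree-last-⊕ (graph (suc (suc a)) E) (graph (suc (suc b)) E') (s≤s (s≤s z≤n) , below) (s≤s (s≤s z≤n)) = begin
  degreeIn (E ++ shifted ++ newEdge) L                  ≡⟨ degreeIn-++ E (shifted ++ newEdge) L ⟩
  degreeIn E L + degreeIn (shifted ++ newEdge) L
    ≡⟨ cong₂ _+_ (degreeIn-avoiding (All.map (¬incident-above (node-bound-⊕ a b)) below)) (degreeIn-++ shifted newEdge L) ⟩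
  degreeIn shifted L + degreeIn newEdge L
    ≡⟨ cong₂ _+_ (cong (degreeIn shifted) (+-suc a (suc b))) (degreeIn-single (0 , L) L (inj₂ refl)) ⟩
  degreeIn shifted (suc a + suc b) + 1                  ≡⟨ cong (_+ 1) (degreeIn-shift (suc a) (suc b) E') ⟩
  degreeIn E' (suc b) + 1                               ≡⟨ +-comm (degreeIn E' (suc b)) 1 ⟩
  suc (degreeIn E' (suc b))                             ∎
  where
    L = a + (2 + b)
    shifted = map (shiftEdge (suc a)) E'
    newEdge = (0 , L) ∷ []

firstDegree lastDegree : FNode → ℕ
firstDegree x = degree (haros x) (firstNode (haros x))
lastDegree x = degree (haros x) (lastNode (haros x))

Neighbours : ℕ → FNode → FNode → Set
Neighbours n x y = WellFormed (haros x) × WellFormed (haros y) × firstDegree x + lastDegree y ≡ n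

module _ {n : ℕ} where

  mediant-wellFormed : ∀ x y → Neighbours n x y → WellFormed (haros (mediant x y))
  mediant-wellFormed (fnode _ _ G) (fnode _ _ G') (wf , wf' , _) = wellFormed-⊕ wf wf'

  firstDegree-mediant : ∀ x y → Neighbours n x y → firstDegree (mediant x y) ≡ suc (firstDegree x)
  firstDegree-mediant (fnode _ _ G) (fnode _ _ G') ((two≤ , _) , _) = degree-first-⊕ G G' two≤

  lastDegree-mediant : ∀ x y → Neighbours n x y → lastDegree (mediant x y) ≡ suc (lastDegree y)
  lastDegree-mediant (fnode _ _ G) (fnode _ _ G') (wf , (two≤ , _) , _) = degree-last-⊕ G G' wf two≤

  neighbours-mediantˡ : ∀ x y → Neighbours n x y → Neighbours (suc n) x (mediant x y)
  neighbours-mediantˡ x y nb@(wf , _ , sum) = wf , mediant-wellFormed x y nb , (begin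
    firstDegree x + lastDegree (mediant x y)  ≡⟨ cong (firstDegree x +_) (lastDegree-mediant x y nb) ⟩
    firstDegree x + suc (lastDegree y)        ≡⟨ +-suc (firstDegree x) (lastDegree y) ⟩
    suc (firstDegree x + lastDegree y)        ≡⟨ cong suc sum ⟩
    suc n                                     ∎)

  neighbours-mediantʳ : ∀ x y → Neighbours n x y → Neighbours (suc n) (mediant x y) y
  neighbours-mediantʳ x y nb@(_ , wf , sum) = mediant-wellFormed x y nb , wf , (begin
    firstDegree (mediant x y) + lastDegree y  ≡⟨ cong (_+ lastDegree y) (firstDegree-mediant x y nb) ⟩
    suc (firstDegree x + lastDegree y)        ≡⟨ cong suc sum ⟩
    suc n                                     ∎)

  endDegrees-mediant : ∀ x y → Neighbours n x y →
    firstDegree (mediant x y) + lastDegree (mediant x y) ≡ suc (suc n)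
  endDegrees-mediant x y nb@(_ , _ , sum) = begin
    firstDegree (mediant x y) + lastDegree (mediant x y)
      ≡⟨ cong₂ _+_ (firstDegree-mediant x y nb) (lastDegree-mediant x y nb) ⟩
    suc (firstDegree x + suc (lastDegree y))  ≡⟨ cong suc (+-suc (firstDegree x) (lastDegree y)) ⟩
    suc (suc (firstDegree x + lastDegree y))  ≡⟨ cong (λ m → suc (suc m)) sum ⟩
    suc (suc n)                               ∎

  refine-neighbours : ∀ {xs} → Linked (Neighbours n) xs → Linked (Neighbours (suc n)) (refine xs)
  refine-neighbours []  = []
  refine-neighbours [-] = [-]
  refine-neighbours {x ∷ y ∷ []} (nb ∷ [-]) =
    neighbours-mediantˡ x y nb ∷ neighbours-mediantʳ x y nb ∷ [-]
  refine-neighbours {x ∷ y ∷ _ ∷ _} (nb ∷ nbs@(_ ∷ _)) =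
    neighbours-mediantˡ x y nb ∷ neighbours-mediantʳ x y nb ∷ refine-neighbours nbs

upTo-neighbours : ∀ k → Linked (Neighbours (k + 2)) (upTo k)
upTo-neighbours zero    = (wellFormed-G₀ , wellFormed-G₀ , refl) ∷ [-]
upTo-neighbours (suc k) = refine-neighbours (upTo-neighbours k)

∈-mediants⁻ : ∀ {ℓ} {R : FNode → FNode → Set ℓ} {xs m} → Linked R xs → m ∈ mediants xs →
  ∃₂ λ x y → R x y × m ≡ mediant x y
∈-mediants⁻ (r ∷ _)  (here refl) = _ , _ , r , refl
∈-mediants⁻ (_ ∷ rs) (there m∈)  = ∈-mediants⁻ rs m∈

lemma5 : (κ : ℕ) → 3 ≤ κ → (x : FNode) → x ∈ level κ →
    degree (haros x) (firstNode (haros x)) + degree (haros x) (lastNode (haros x)) ≡ κ + 2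
lemma5 (suc (suc (suc k))) (s≤s (s≤s (s≤s z≤n))) x x∈ with ∈-mediants⁻ (upTo-neighbours (suc k)) x∈
... | y , z , nb , refl = endDegrees-mediant y z nb
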